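{- Let $p$ and $q$ be distinct primes and $N=pq$. For $k\in\{p,q\}$ (viewed in $\mathbb{Z}/N\mathbb{Z}$), every minimal $k$-monomial solution of $(E_N)$ is irreducible.
   Context: For $a_1,\dots,a_n\in\mathbb{Z}/N\mathbb{Z}$ set $M_n(a_1,\dots,a_n)=\begin{pmatrix}a_n&-1\\1&0\end{pmatrix}\cdots\begin{pmatrix}a_1&-1\\1&0\end{pmatrix}$. An $n$-tuple is a solution of $(E_N)$ if $M_n(a_1,\dots,a_n)=\pm\mathrm{Id}$ over $\mathbb{Z}/N\mathbb{Z}$. For $k\in\mathbb{Z}/N\mathbb{Z}$, a minimal $k$-monomial solution is a solution $(k,\dots,k)\in(\mathbb{Z}/N\mathbb{Z})^n$ where $n\ge1$ is the smallest integer for which $(k,\dots,k)\in(\mathbb{Z}/N\mathbb{Z})^n$ is a solution. The sum of $(a_1,\dots,a_n)$ and $(b_1,\dots,b_m)$ is $(a_1+b_m,a_2,\dots,a_{n-1},a_n+b_1,b_2,\dots,b_{m-1})$. Two $n$-tuples are equivalent ($\sim$) if one is a cyclic permutation of the other or of its reversal. A solution $(c_1,\dots,c_n)$ with $n\ge3$ is reducible if there exist solutions $(a_1,\dots,a_m)$, $(b_1,\dots,b_l)$ with $m,l\ge3$ and $(c_1,\dots,c_n)\sim(a_1,\dots,a_m)\oplus(b_1,\dots,b_l)$; irreducible otherwise. -}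

module Defs where

open import Data.Nat using (ℕ; zero; suc; _≤_; _<_)
open import Data.Nat.Primality using (Prime)
open import Data.Integer using (ℤ; +_; _+_; _-_; _*_; -_)
open import Data.Integer.Divisibility using (_∣_)
open import Data.List using (List; []; _∷_; _++_; length; reverse; drop; take; replicate)
open import Data.List.Relation.Binary.Pointwise using (Pointwise)
open import Data.Product using (_×_; _,_; ∃; ∃-syntax; proj₁; proj₂)
open import Data.Sum using (_⊎_)
open import Relation.Nullary using (¬_)

-- Elements of ℤ/Nℤ are represented by integers; equality in ℤ/Nℤ is congruence mod N.
_≡_[mod_] : ℤ → ℤ → ℕ → Set
a ≡ b [mod N ] = (+ N) ∣ (a - b)

record Mat : Set where
  constructor mat
  field
    m11 m12 m21 m22 : ℤ

_⊗_ : Mat → Mat → Mat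
mat a b c d ⊗ mat e f g h = mat (a * e + b * g) (a * f + b * h) (c * e + d * g) (c * f + d * h)

Id : Mat
Id = mat (+ 1) (+ 0) (+ 0) (+ 1)

Mk : ℤ → Mat
Mk a = mat a (- (+ 1)) (+ 1) (+ 0)

-- M_n(a_1,…,a_n) = Mk a_n ⋯ Mk a_1
Mn-acc : Mat → List ℤ → Mat
Mn-acc acc [] = acc
Mn-acc acc (a ∷ as) = Mn-acc (Mk a ⊗ acc) as

Mn : List ℤ → Mat
Mn = Mn-acc Id

MatCong : ℕ → Mat → Mat → Set
MatCong N (mat a b c d) (mat e f g h) =
  (a ≡ e [mod N ]) × (b ≡ f [mod N ]) × (c ≡ g [mod N ]) × (d ≡ h [mod N ])

negMat : Mat → Mat
negMat (mat a b c d) = mat (- a) (- b) (- c) (- d)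

IsSolution : ℕ → List ℤ → Set
IsSolution N as = MatCong N (Mn as) Id ⊎ MatCong N (Mn as) (negMat Id)

IsMinimalMonomial : ℕ → ℤ → ℕ → Set
IsMinimalMonomial N k n =
  1 ≤ n × IsSolution N (replicate n k) ×
  (∀ m → 1 ≤ m → m < n → ¬ IsSolution N (replicate m k))

initLast : ℤ → List ℤ → List ℤ × ℤ
initLast x [] = [] , x
initLast x (y ∷ ys) = let r = initLast y ys in (x ∷ proj₁ r) , proj₂ r

-- (a_1,…,a_n) ⊕ (b_1,…,b_m) = (a_1+b_m, a_2,…,a_{n-1}, a_n+b_1, b_2,…,b_{m-1})
-- (only meaningful for n, m ≥ 2; returns [] otherwise)
_⊕_ : List ℤ → List ℤ → List ℤ
(a₁ ∷ a₂ ∷ as) ⊕ (b₁ ∷ b₂ ∷ bs) =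
  let A = initLast a₂ as
      B = initLast b₂ bs
  in (a₁ + proj₂ B) ∷ proj₁ A ++ ((proj₂ A + b₁) ∷ proj₁ B)
_ ⊕ _ = []

rotate : ℕ → List ℤ → List ℤ
rotate i xs = drop i xs ++ take i xs

Equiv : ℕ → List ℤ → List ℤ → Set
Equiv N xs ys = ∃[ i ] (i < length ys ×
  (Pointwise (λ a b → a ≡ b [mod N ]) xs (rotate i ys)
   ⊎ Pointwise (λ a b → a ≡ b [mod N ]) xs (rotate i (reverse ys))))

Reducible : ℕ → List ℤ → Set
Reducible N cs = ∃[ as ] ∃[ bs ] (IsSolution N as × IsSolution N bs ×
  3 ≤ length as × 3 ≤ length bs × Equiv N cs (as ⊕ bs))

Irreducible : ℕ → List ℤ → Set
Irreducible N cs = ¬ Reducible N cs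

module Submission where

-- Suppose (k, …, k) ∼ a ⊕ b with a, b solutions of length at least 3. Then a has the
-- shape (a₁, k, …, k, aₘ) with j ≥ 1 interior entries, and j + 2 < n. The product
-- M_j(k, …, k) is a polynomial in Mk k, hence of the form x·Id + y·(k·Id − Mk k); writing
-- out Mk aₘ · (x·Id + y·(k·Id − Mk k)) · Mk a₁ = ±Id gives a₁ ≡ aₘ and a₁ (k − a₁) ≡ 0
-- (mod N). For N = pq and k = p, p divides a₁ either way and q divides a₁ or p − a₁, so
-- a₁ ≡ 0 or a₁ ≡ p. If a₁ ≡ 0 then (0, k, …, k, 0) is a solution, hence so is the
-- j-tuple (k, …, k); if a₁ ≡ p then a itself is the (j + 2)-tuple (k, …, k). Both
-- contradict the minimality of n.

open import Defs
open import Data.Empty using (⊥-elim)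
open import Data.Integer as Integer using (ℤ; +_; ∣_∣)
open import Data.Integer.Divisibility.Signed as Signed using (∣ᵤ⇒∣; ∣⇒∣ᵤ)
open import Data.Integer.Properties
  using (+-inverseʳ; +-identityˡ; +-identityʳ; *-assoc; *-identityˡ; neg-involutive; abs-*)
open import Data.Integer.Tactic.RingSolver using (solve-∀)
open import Data.List using (List; []; _∷_; _++_; length; reverse; drop; take; replicate)
open import Data.List.Properties using (take++drop≡id; length-replicate)
open import Data.List.Relation.Binary.Permutation.Propositional using (_↭_; ↭-trans; ↭-reflexive)
open import Data.List.Relation.Binary.Permutation.Propositional.Properties
  using (All-resp-↭; ↭-length; ++-comm; ↭-reverse)
open import Data.List.Relation.Binary.Pointwise as Pointwise
  using (Pointwise; []; _∷_; All-resp-Pointwise; Pointwise-length)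
open import Data.List.Relation.Unary.All as All using (All; []; _∷_)
import Data.List.Relation.Unary.All.Properties as All
open import Data.Nat as ℕ using (ℕ; zero; suc; _≤_; _<_; s≤s; z≤n)
open import Data.Nat.Coprimality as Coprimality using (Coprime; coprime-divisor)
open import Data.Nat.Divisibility as ℕ∣ using (divides; m∣m*n; n∣m*n; *-monoʳ-∣)
open import Data.Nat.Primality using (Prime; euclidsLemma; prime⇒irreducible; ¬prime[1])
open import Data.Nat.Properties using (*-comm; m+n≤o⇒n≤o)
open import Data.Product using (_×_; _,_; ∃₂; ∃-syntax; proj₁; proj₂)
open import Data.Sum as Sum using (_⊎_; inj₁; inj₂; [_,_]′)
open import Function using (_∘_)
open import Level using (0ℓ)
open import Relation.Binary.Bundles using (Setoid)
open import Relation.Binary.Core using (_⇒_)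
open import Relation.Binary.Definitions using (Reflexive; Symmetric; Transitive)
open import Relation.Binary.Structures using (IsEquivalence)
import Relation.Binary.Reasoning.Setoid
open import Relation.Binary.PropositionalEquality
  using (_≡_; _≢_; refl; sym; trans; cong; cong₂; subst; module ≡-Reasoning)

replicate-++-∷ : ∀ {A : Set} n (x : A) → replicate n x ++ x ∷ [] ≡ replicate (suc n) x
replicate-++-∷ zero    x = refl
replicate-++-∷ (suc n) x = cong (x ∷_) (replicate-++-∷ n x)

All⇒Pointwise-replicate : ∀ {A : Set} {R : A → A → Set} {k xs} →
  All (λ x → R x k) xs → Pointwise R xs (replicate (length xs) k)
All⇒Pointwise-replicate []       = []
All⇒Pointwise-replicate (r ∷ rs) = r ∷ All⇒Pointwise-replicate rs

length-++-∷-∷ : ∀ {A : Set} (xs : List A) {y z ys} →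
  suc (suc (length xs)) ≤ length (xs ++ y ∷ z ∷ ys)
length-++-∷-∷ []       = s≤s (s≤s z≤n)
length-++-∷-∷ (x ∷ xs) = s≤s (length-++-∷-∷ xs)

rotate-↭ : ∀ i xs → rotate i xs ↭ xs
rotate-↭ i xs = ↭-trans (++-comm (drop i xs) (take i xs)) (↭-reflexive (take++drop≡id i xs))

initLast-++ : ∀ x xs → x ∷ xs ≡ proj₁ (initLast x xs) ++ proj₂ (initLast x xs) ∷ []
initLast-++ x []       = refl
initLast-++ x (y ∷ ys) = cong (x ∷_) (initLast-++ y ys)

⊕-interior : ∀ {P : ℤ → Set} a b → 3 ≤ length a → 3 ≤ length b → All P (a ⊕ b) →
  ∃[ a₁ ] ∃[ mid ] ∃[ aₘ ] (a ≡ a₁ ∷ mid ++ aₘ ∷ [] × All P mid ×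
                           1 ≤ length mid × suc (suc (length mid)) < length (a ⊕ b))
⊕-interior (a₁ ∷ a₂ ∷ a₃ ∷ as) (b₁ ∷ b₂ ∷ b₃ ∷ bs) _ _ (_ ∷ P-a⊕b) =
  a₁ , mid , proj₂ (initLast a₂ (a₃ ∷ as)) , cong (a₁ ∷_) (initLast-++ a₂ (a₃ ∷ as)) ,
  All.++⁻ˡ mid P-a⊕b , s≤s z≤n , s≤s (length-++-∷-∷ mid)
  where mid = proj₁ (initLast a₂ (a₃ ∷ as))
⊕-interior []              _            ()             _
⊕-interior (_ ∷ [])        _            (s≤s ())       _
⊕-interior (_ ∷ _ ∷ [])    _            (s≤s (s≤s ())) _
⊕-interior (_ ∷ _ ∷ _ ∷ _) []           _              ()
⊕-interior (_ ∷ _ ∷ _ ∷ _) (_ ∷ [])     _              (s≤s ())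
⊕-interior (_ ∷ _ ∷ _ ∷ _) (_ ∷ _ ∷ []) _              (s≤s (s≤s ()))

module _ where

  open Integer using (_+_; _-_; _*_; -_)

  mat-cong : ∀ {a b c d a′ b′ c′ d′} → a ≡ a′ → b ≡ b′ → c ≡ c′ → d ≡ d′ →
             mat a b c d ≡ mat a′ b′ c′ d′
  mat-cong refl refl refl refl = refl

  ⊗-assoc : ∀ A B C → (A ⊗ B) ⊗ C ≡ A ⊗ (B ⊗ C)
  ⊗-assoc (mat a b c d) (mat e f g h) (mat i j k l) =
    mat-cong (entry a b e f g h i k) (entry a b e f g h j l)
             (entry c d e f g h i k) (entry c d e f g h j l)
    where
    entry : ∀ a b e f g h i k →
      (a * e + b * g) * i + (a * f + b * h) * k ≡ a * (e * i + f * k) + b * (g * i + h * k)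
    entry = solve-∀

  ⊗-identityˡ : ∀ A → Id ⊗ A ≡ A
  ⊗-identityˡ (mat a b c d) = mat-cong (top a c) (top b d) (bottom a c) (bottom b d)
    where
    top : ∀ a c → + 1 * a + + 0 * c ≡ a
    top = solve-∀
    bottom : ∀ a c → + 0 * a + + 1 * c ≡ c
    bottom = solve-∀

  ⊗-identityʳ : ∀ A → A ⊗ Id ≡ A
  ⊗-identityʳ (mat a b c d) = mat-cong (left a b) (right a b) (left c d) (right c d)
    where
    left : ∀ a b → a * + 1 + b * + 0 ≡ a
    left = solve-∀
    right : ∀ a b → a * + 0 + b * + 1 ≡ b
    right = solve-∀

  Mn-acc-⊗ : ∀ A B xs → Mn-acc (A ⊗ B) xs ≡ Mn-acc A xs ⊗ B
  Mn-acc-⊗ A B []       = refl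
  Mn-acc-⊗ A B (x ∷ xs) = begin
    Mn-acc (Mk x ⊗ (A ⊗ B)) xs  ≡⟨ cong (λ C → Mn-acc C xs) (⊗-assoc (Mk x) A B) ⟨
    Mn-acc ((Mk x ⊗ A) ⊗ B) xs  ≡⟨ Mn-acc-⊗ (Mk x ⊗ A) B xs ⟩
    Mn-acc (Mk x ⊗ A) xs ⊗ B    ∎
    where open ≡-Reasoning

  Mn-acc≡Mn-⊗ : ∀ A xs → Mn-acc A xs ≡ Mn xs ⊗ A
  Mn-acc≡Mn-⊗ A xs = trans (cong (λ C → Mn-acc C xs) (sym (⊗-identityˡ A))) (Mn-acc-⊗ Id A xs)

  Mn-acc-++ : ∀ A xs ys → Mn-acc A (xs ++ ys) ≡ Mn-acc (Mn-acc A xs) ys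
  Mn-acc-++ A []       ys = refl
  Mn-acc-++ A (x ∷ xs) ys = Mn-acc-++ (Mk x ⊗ A) xs ys

  Mn-bordered : ∀ a xs b → Mn (a ∷ xs ++ b ∷ []) ≡ Mk b ⊗ (Mn xs ⊗ Mk a)
  Mn-bordered a xs b = begin
    Mn-acc (Mk a ⊗ Id) (xs ++ b ∷ [])  ≡⟨ Mn-acc-++ (Mk a ⊗ Id) xs (b ∷ []) ⟩
    Mk b ⊗ Mn-acc (Mk a ⊗ Id) xs       ≡⟨ cong (Mk b ⊗_) (Mn-acc≡Mn-⊗ (Mk a ⊗ Id) xs) ⟩
    Mk b ⊗ (Mn xs ⊗ (Mk a ⊗ Id))       ≡⟨ cong (λ C → Mk b ⊗ (Mn xs ⊗ C)) (⊗-identityʳ (Mk a)) ⟩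
    Mk b ⊗ (Mn xs ⊗ Mk a)              ∎
    where open ≡-Reasoning

  -- x·Id + y·(k·Id − Mk k); these are exactly the integer polynomials in Mk k
  polyMk : ℤ → ℤ → ℤ → Mat
  polyMk k x y = mat x y (- y) (x + k * y)

  polyMk-⊗-Mk : ∀ k x y → polyMk k x y ⊗ Mk k ≡ polyMk k (x * k + y) (- x)
  polyMk-⊗-Mk k x y = mat-cong (e₁₁ k x y) (e₁₂ k x y) (e₂₁ k x y) (e₂₂ k x y)
    where
    e₁₁ : ∀ k x y → x * k + y * + 1 ≡ x * k + y
    e₁₁ = solve-∀
    e₁₂ : ∀ k x y → x * - (+ 1) + y * + 0 ≡ - x
    e₁₂ = solve-∀
    e₂₁ : ∀ k x y → - y * k + (x + k * y) * + 1 ≡ - - x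
    e₂₁ = solve-∀
    e₂₂ : ∀ k x y → - y * - (+ 1) + (x + k * y) * + 0 ≡ x * k + y + k * - x
    e₂₂ = solve-∀

  Mn-replicate : ∀ k j → ∃₂ λ x y → Mn (replicate j k) ≡ polyMk k x y
  Mn-replicate k zero    = + 1 , + 0 , mat-cong refl refl refl (one k)
    where
    one : ∀ k → + 1 ≡ + 1 + k * + 0
    one = solve-∀
  Mn-replicate k (suc j) with x , y , Mn≡polyMk ← Mn-replicate k j =
    x * k + y , - x , (begin
      Mn-acc (Mk k ⊗ Id) (replicate j k)  ≡⟨ Mn-acc≡Mn-⊗ (Mk k ⊗ Id) (replicate j k) ⟩
      Mn (replicate j k) ⊗ (Mk k ⊗ Id)    ≡⟨ cong₂ _⊗_ Mn≡polyMk (⊗-identityʳ (Mk k)) ⟩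
      polyMk k x y ⊗ Mk k                 ≡⟨ polyMk-⊗-Mk k x y ⟩
      polyMk k (x * k + y) (- x)          ∎)
    where open ≡-Reasoning

  polyMk-bordered : ∀ k x y a b → Mk b ⊗ (polyMk k x y ⊗ Mk a) ≡
    mat (b * (x * a + y) + y * a - x - k * y) (- (b * x) - y) (x * a + y) (- x)
  polyMk-bordered k x y a b =
    mat-cong (e₁₁ k x y a b) (e₁₂ k x y a b) (e₂₁ k x y a b) (e₂₂ k x y a b)
    where
    e₁₁ : ∀ k x y a b → b * (x * a + y * + 1) + - (+ 1) * (- y * a + (x + k * y) * + 1) ≡
                        b * (x * a + y) + y * a - x - k * y
    e₁₁ = solve-∀
    e₁₂ : ∀ k x y a b → b * (x * - (+ 1) + y * + 0) + - (+ 1) * (- y * - (+ 1) + (x + k * y) * + 0) ≡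
                        - (b * x) - y
    e₁₂ = solve-∀
    e₂₁ : ∀ k x y a b → + 1 * (x * a + y * + 1) + + 0 * (- y * a + (x + k * y) * + 1) ≡ x * a + y
    e₂₁ = solve-∀
    e₂₂ : ∀ k x y a b → + 1 * (x * - (+ 1) + y * + 0) + + 0 * (- y * - (+ 1) + (x + k * y) * + 0) ≡ - x
    e₂₂ = solve-∀

  Mk0-conjugate : ∀ A → let open Mat A in
    Mk (+ 0) ⊗ (A ⊗ Mk (+ 0)) ≡ mat (- m22) m21 m12 (- m11)
  Mk0-conjugate (mat a b c d) = mat-cong (e₁₁ a b c d) (e₁₂ a b c d) (e₂₁ a b c d) (e₂₂ a b c d)
    where
    e₁₁ : ∀ a b c d → + 0 * (a * + 0 + b * + 1) + - (+ 1) * (c * + 0 + d * + 1) ≡ - d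
    e₁₁ = solve-∀
    e₁₂ : ∀ a b c d → + 0 * (a * - (+ 1) + b * + 0) + - (+ 1) * (c * - (+ 1) + d * + 0) ≡ c
    e₁₂ = solve-∀
    e₂₁ : ∀ a b c d → + 1 * (a * + 0 + b * + 1) + + 0 * (c * + 0 + d * + 1) ≡ b
    e₂₁ = solve-∀
    e₂₂ : ∀ a b c d → + 1 * (a * - (+ 1) + b * + 0) + + 0 * (c * - (+ 1) + d * + 0) ≡ - a
    e₂₂ = solve-∀

  scalar : ℤ → Mat
  scalar s = mat s (+ 0) (+ 0) s

module Congruence (N : ℕ) where

  open Integer using (_+_; _-_; _*_; -_)

  infix 4 _≈_ _≋_

  -- A record rather than a ≡ b [mod N ] itself, so that a and b can be inferred.
  record _≈_ (a b : ℤ) : Set where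
    constructor divides-difference
    field divisor : + N Signed.∣ a - b
  open _≈_ public

  _via_ : ∀ {a b d} → + N Signed.∣ d → a - b ≡ d → a ≈ b
  N∣d via refl = divides-difference N∣d

  ≈⇒mod : ∀ {a b} → a ≈ b → a ≡ b [mod N ]
  ≈⇒mod = ∣⇒∣ᵤ ∘ divisor

  mod⇒≈ : ∀ {a b} → a ≡ b [mod N ] → a ≈ b
  mod⇒≈ = divides-difference ∘ ∣ᵤ⇒∣

  ≈-reflexive : _≡_ ⇒ _≈_
  ≈-reflexive {a} refl = Signed.divides (+ 0) refl via +-inverseʳ a

  ≈-refl : Reflexive _≈_
  ≈-refl = ≈-reflexive refl

  ≈-sym : Symmetric _≈_
  ≈-sym {a} {b} a≈b = Signed.∣m⇒∣-m (divisor a≈b) via swap a b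
    where
    swap : ∀ a b → b - a ≡ - (a - b)
    swap = solve-∀

  ≈-trans : Transitive _≈_
  ≈-trans {a} {b} {c} a≈b b≈c =
    Signed.∣m∣n⇒∣m+n (divisor a≈b) (divisor b≈c) via split a b c
    where
    split : ∀ a b c → a - c ≡ (a - b) + (b - c)
    split = solve-∀

  ≈-isEquivalence : IsEquivalence _≈_
  ≈-isEquivalence = record { refl = ≈-refl ; sym = ≈-sym ; trans = ≈-trans }

  ≈-setoid : Setoid 0ℓ 0ℓ
  ≈-setoid = record { isEquivalence = ≈-isEquivalence }

  module ≈-Reasoning = Relation.Binary.Reasoning.Setoid ≈-setoid

  +-cong : ∀ {a b c d} → a ≈ b → c ≈ d → a + c ≈ b + d
  +-cong {a} {b} {c} {d} a≈b c≈d =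
    Signed.∣m∣n⇒∣m+n (divisor a≈b) (divisor c≈d) via split a b c d
    where
    split : ∀ a b c d → (a + c) - (b + d) ≡ (a - b) + (c - d)
    split = solve-∀

  *-cong : ∀ {a b c d} → a ≈ b → c ≈ d → a * c ≈ b * d
  *-cong {a} {b} {c} {d} a≈b c≈d =
    Signed.∣m∣n⇒∣m+n (Signed.∣n⇒∣m*n c (divisor a≈b)) (Signed.∣n⇒∣m*n b (divisor c≈d))
      via split a b c d
    where
    split : ∀ a b c d → a * c - b * d ≡ c * (a - b) + b * (c - d)
    split = solve-∀

  *-congˡ : ∀ c {a b} → a ≈ b → c * a ≈ c * b
  *-congˡ c = *-cong (≈-refl {c})

  *-congʳ : ∀ c {a b} → a ≈ b → a * c ≈ b * c
  *-congʳ c a≈b = *-cong a≈b (≈-refl {c})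

  -‿cong : ∀ {a b} → a ≈ b → - a ≈ - b
  -‿cong {a} {b} a≈b = Signed.∣m⇒∣-m (divisor a≈b) via split a b
    where
    split : ∀ a b → - a - - b ≡ - (a - b)
    split = solve-∀

  -‿swap : ∀ {a b} → - a ≈ b → a ≈ - b
  -‿swap {a} -a≈b = subst (_≈ _) (neg-involutive a) (-‿cong -a≈b)

  cancel-unit : ∀ s {u v} → s * s ≡ + 1 → s * u ≈ s * v → u ≈ v
  cancel-unit s {u} {v} s²≡1 su≈sv = begin
    u            ≡⟨ s[su]≡u u ⟨
    s * (s * u)  ≈⟨ *-congˡ s su≈sv ⟩
    s * (s * v)  ≡⟨ s[su]≡u v ⟩
    v            ∎
    where
    open ≈-Reasoning
    s[su]≡u : ∀ u → s * (s * u) ≡ u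
    s[su]≡u u = trans (sym (*-assoc s s u)) (trans (cong (_* u) s²≡1) (*-identityˡ u))

  _≋_ : Mat → Mat → Set
  mat a b c d ≋ mat a′ b′ c′ d′ = a ≈ a′ × b ≈ b′ × c ≈ c′ × d ≈ d′

  ≋-refl : ∀ {A} → A ≋ A
  ≋-refl = ≈-refl , ≈-refl , ≈-refl , ≈-refl

  ≋-sym : ∀ {A B} → A ≋ B → B ≋ A
  ≋-sym (a , b , c , d) = ≈-sym a , ≈-sym b , ≈-sym c , ≈-sym d

  ≋-trans : ∀ {A B C} → A ≋ B → B ≋ C → A ≋ C
  ≋-trans (a , b , c , d) (a′ , b′ , c′ , d′) =
    ≈-trans a a′ , ≈-trans b b′ , ≈-trans c c′ , ≈-trans d d′

  ⊗-cong : ∀ {A A′ B B′} → A ≋ A′ → B ≋ B′ → A ⊗ B ≋ A′ ⊗ B′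
  ⊗-cong (a , b , c , d) (e , f , g , h) =
    +-cong (*-cong a e) (*-cong b g) , +-cong (*-cong a f) (*-cong b h) ,
    +-cong (*-cong c e) (*-cong d g) , +-cong (*-cong c f) (*-cong d h)

  Mn-acc-cong : ∀ {A B xs ys} → A ≋ B → Pointwise _≈_ xs ys → Mn-acc A xs ≋ Mn-acc B ys
  Mn-acc-cong A≋B []                                  = A≋B
  Mn-acc-cong {xs = x ∷ _} {y ∷ _} A≋B (x≈y ∷ xs≈ys) =
    Mn-acc-cong (⊗-cong {Mk x} {Mk y} (x≈y , ≈-refl , ≈-refl , ≈-refl) A≋B) xs≈ys

  MatCong⇒≋ : ∀ {A B} → MatCong N A B → A ≋ B
  MatCong⇒≋ (a , b , c , d) = mod⇒≈ a , mod⇒≈ b , mod⇒≈ c , mod⇒≈ d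

  ≋⇒MatCong : ∀ {A B} → A ≋ B → MatCong N A B
  ≋⇒MatCong (a , b , c , d) = ≈⇒mod a , ≈⇒mod b , ≈⇒mod c , ≈⇒mod d

  solution⇒≋ : ∀ {xs} → IsSolution N xs → Mn xs ≋ scalar (+ 1) ⊎ Mn xs ≋ scalar (- + 1)
  solution⇒≋ {xs} = Sum.map (MatCong⇒≋ {Mn xs}) (MatCong⇒≋ {Mn xs})

  ≋⇒solution : ∀ {xs} → Mn xs ≋ scalar (+ 1) ⊎ Mn xs ≋ scalar (- + 1) → IsSolution N xs
  ≋⇒solution {xs} = Sum.map (≋⇒MatCong {Mn xs}) (≋⇒MatCong {Mn xs})

  IsSolution-cong : ∀ {xs ys} → Pointwise _≈_ xs ys → IsSolution N xs → IsSolution N ys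
  IsSolution-cong {xs} {ys} xs≈ys =
    ≋⇒solution {ys} ∘ Sum.map transport transport ∘ solution⇒≋ {xs}
    where
    transport : ∀ {S} → Mn xs ≋ S → Mn ys ≋ S
    transport = ≋-trans (≋-sym (Mn-acc-cong {Id} {Id} ≋-refl xs≈ys))

  bordered-replicate-cong : ∀ {a a′ b b′ k} j → a ≈ a′ → b ≈ b′ →
    IsSolution N (a ∷ replicate j k ++ b ∷ []) → IsSolution N (a′ ∷ replicate j k ++ b′ ∷ [])
  bordered-replicate-cong {a} {a′} {b} {b′} {k} j a≈a′ b≈b′ =
    IsSolution-cong {a ∷ replicate j k ++ b ∷ []} {a′ ∷ replicate j k ++ b′ ∷ []}
      (a≈a′ ∷ Pointwise.++⁺ (Pointwise.refl ≈-refl) (b≈b′ ∷ []))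

  unborder-zeros : ∀ xs → IsSolution N (+ 0 ∷ xs ++ + 0 ∷ []) → IsSolution N xs
  unborder-zeros xs =
    ≋⇒solution {xs} ∘ [ inj₂ ∘ unconjugate , inj₁ ∘ unconjugate ]′ ∘
    solution⇒≋ {+ 0 ∷ xs ++ + 0 ∷ []}
    where
    unconjugate : ∀ {s} → Mn (+ 0 ∷ xs ++ + 0 ∷ []) ≋ scalar s → Mn xs ≋ scalar (- s)
    unconjugate {s} h
      with -d≈s , c≈0 , b≈0 , -a≈s ← subst (_≋ scalar s)
             (trans (Mn-bordered (+ 0) xs (+ 0)) (Mk0-conjugate (Mn xs))) h
      = -‿swap -a≈s , b≈0 , c≈0 , -‿swap -d≈s

  bordered-polyMk-congruences : ∀ {k x y a b s} → s * s ≡ + 1 →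
    mat (b * (x * a + y) + y * a - x - k * y) (- (b * x) - y) (x * a + y) (- x) ≋ scalar s →
    a ≈ b × a * (k - a) ≈ + 0
  bordered-polyMk-congruences {k} {x} {y} {a} {b} {s} s²≡1 (m₁₁≈s , m₁₂≈0 , m₂₁≈0 , -x≈s) =
    cancel-unit s s²≡1 (≈-trans (≈-sym y≈sa) y≈sb) , cancel-unit s s²≡1 s[a[k-a]]≈s0
    where
    open ≈-Reasoning
    y≈sa : y ≈ s * a
    y≈sa = begin
      y                      ≡⟨ e x y a ⟩
      (x * a + y) + - x * a  ≈⟨ +-cong m₂₁≈0 (*-congʳ a -x≈s) ⟩
      + 0 + s * a            ≡⟨ +-identityˡ (s * a) ⟩
      s * a                  ∎
      where
      e : ∀ x y a → y ≡ (x * a + y) + - x * a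
      e = solve-∀
    y≈sb : y ≈ s * b
    y≈sb = begin
      y                            ≡⟨ e x y b ⟩
      - (- (b * x) - y) + - x * b  ≈⟨ +-cong (-‿cong m₁₂≈0) (*-congʳ b -x≈s) ⟩
      + 0 + s * b                  ≡⟨ +-identityˡ (s * b) ⟩
      s * b                        ∎
      where
      e : ∀ x y b → y ≡ - (- (b * x) - y) + - x * b
      e = solve-∀
    s[a[k-a]]≈s0 : s * (a * (k - a)) ≈ s * + 0
    s[a[k-a]]≈s0 = begin
      s * (a * (k - a))  ≡⟨ *-assoc s a (k - a) ⟨
      s * a * (k - a)    ≈⟨ *-congʳ (k - a) (≈-sym y≈sa) ⟩
      y * (k - a)        ≡⟨ e k x y a b ⟩
      b * (x * a + y) + - x - (b * (x * a + y) + y * a - x - k * y)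
                         ≈⟨ +-cong (+-cong (*-congˡ b m₂₁≈0) -x≈s) (-‿cong m₁₁≈s) ⟩
      b * + 0 + s - s    ≡⟨ e′ b s ⟩
      s * + 0            ∎
      where
      e : ∀ k x y a b → y * (k - a) ≡ b * (x * a + y) + - x - (b * (x * a + y) + y * a - x - k * y)
      e = solve-∀
      e′ : ∀ b s → b * + 0 + s - s ≡ s * + 0
      e′ = solve-∀

  replicate-bordered-congruences : ∀ {a b k} j → IsSolution N (a ∷ replicate j k ++ b ∷ []) →
    a ≈ b × a * (k - a) ≈ + 0
  replicate-bordered-congruences {a} {b} {k} j sol
    with x , y , Mn≡polyMk ← Mn-replicate k j
    = [ from-scalar refl ∘ normalise , from-scalar refl ∘ normalise ]′
        (solution⇒≋ {a ∷ replicate j k ++ b ∷ []} sol)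
    where
    normal-form : Mn (a ∷ replicate j k ++ b ∷ []) ≡
      mat (b * (x * a + y) + y * a - x - k * y) (- (b * x) - y) (x * a + y) (- x)
    normal-form = begin
      Mn (a ∷ replicate j k ++ b ∷ [])    ≡⟨ Mn-bordered a (replicate j k) b ⟩
      Mk b ⊗ (Mn (replicate j k) ⊗ Mk a)  ≡⟨ cong (λ R → Mk b ⊗ (R ⊗ Mk a)) Mn≡polyMk ⟩
      Mk b ⊗ (polyMk k x y ⊗ Mk a)        ≡⟨ polyMk-bordered k x y a b ⟩
      _                                   ∎
      where open ≡-Reasoning
    normalise : ∀ {S} → Mn (a ∷ replicate j k ++ b ∷ []) ≋ S → _ ≋ S
    normalise {S} = subst (_≋ S) normal-form
    from-scalar : ∀ {s} → s * s ≡ + 1 → _ ≋ scalar s → a ≈ b × a * (k - a) ≈ + 0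
    from-scalar = bordered-polyMk-congruences {k} {x} {y} {a} {b}

  replicate-≈-↭ : ∀ {n k ys zs} → ys ↭ zs →
    Pointwise (λ a b → a ≡ b [mod N ]) (replicate n k) ys → All (_≈ k) zs × n ≡ length zs
  replicate-≈-↭ {n} σ kⁿ≈ys =
    All-resp-↭ σ (All-resp-Pointwise (λ x≈y x≈k → ≈-trans (≈-sym x≈y) x≈k)
                   (Pointwise.map mod⇒≈ kⁿ≈ys) (All.replicate⁺ n ≈-refl)) ,
    trans (sym (length-replicate n)) (trans (Pointwise-length kⁿ≈ys) (↭-length σ))

  Equiv-replicate : ∀ {n k zs} → Equiv N (replicate n k) zs → All (_≈ k) zs × n ≡ length zs
  Equiv-replicate {zs = zs} (i , _ , inj₁ kⁿ≈σzs) = replicate-≈-↭ (rotate-↭ i zs) kⁿ≈σzs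
  Equiv-replicate {zs = zs} (i , _ , inj₂ kⁿ≈σzs) =
    replicate-≈-↭ (↭-trans (rotate-↭ i (reverse zs)) (↭-reverse zs)) kⁿ≈σzs

prime-∣-* : ∀ {p} → Prime p → ∀ x y →
  + p Signed.∣ x Integer.* y → + p Signed.∣ x ⊎ + p Signed.∣ y
prime-∣-* {p} p-prime x y p∣xy = Sum.map ∣ᵤ⇒∣ ∣ᵤ⇒∣
  (euclidsLemma ∣ x ∣ ∣ y ∣ p-prime (subst (ℕ∣._∣_ p) (abs-* x y) (∣⇒∣ᵤ p∣xy)))

distinct-primes-coprime : ∀ {p q} → Prime p → Prime q → p ≢ q → Coprime p q
distinct-primes-coprime p-prime q-prime p≢q (d∣p , d∣q) with prime⇒irreducible p-prime d∣p
... | inj₁ d≡1 = d≡1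
... | inj₂ refl with prime⇒irreducible q-prime d∣q
...   | inj₁ refl = ⊥-elim (¬prime[1] p-prime)
...   | inj₂ p≡q  = ⊥-elim (p≢q p≡q)

coprime-∣⇒*∣ : ∀ {p q n} → Coprime p q → p ℕ∣.∣ n → q ℕ∣.∣ n → p ℕ.* q ℕ∣.∣ n
coprime-∣⇒*∣ {p} {q} p⊥q (divides o refl) q∣op =
  subst (ℕ∣._∣_ (p ℕ.* q)) (*-comm p o)
    (*-monoʳ-∣ p (coprime-divisor (Coprimality.sym p⊥q) (subst (ℕ∣._∣_ q) (*-comm o p) q∣op)))

module _ {p q : ℕ} (p-prime : Prime p) (q-prime : Prime q) (p≢q : p ≢ q) where

  open Integer using (_-_; _*_)
  open Congruence (p ℕ.* q)
  open Signed using (_∣_; ∣-refl; ∣-trans; ∣m∣n⇒∣m-n)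

  a[p-a]≈0⇒a≈0⊎a≈p : ∀ a → a * (+ p - a) ≈ + 0 → a ≈ + 0 ⊎ a ≈ + p
  a[p-a]≈0⇒a≈0⊎a≈p a a[p-a]≈0 =
    Sum.map (λ q∣a → pq∣ p∣a q∣a via +-identityʳ a)
            (λ q∣p-a → ≈-sym (pq∣ p∣p-a q∣p-a via refl))
            (prime-∣-* q-prime a (+ p - a) (∣-trans (∣ᵤ⇒∣ (n∣m*n p)) pq∣a[p-a]))
    where
    pq∣ : ∀ {x} → + p ∣ x → + q ∣ x → + (p ℕ.* q) ∣ x
    pq∣ p∣x q∣x =
      ∣ᵤ⇒∣ (coprime-∣⇒*∣ (distinct-primes-coprime p-prime q-prime p≢q) (∣⇒∣ᵤ p∣x) (∣⇒∣ᵤ q∣x))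
    pq∣a[p-a] : + (p ℕ.* q) ∣ a * (+ p - a)
    pq∣a[p-a] = subst (_ ∣_) (+-identityʳ _) (divisor a[p-a]≈0)
    p-[p-a]≡a : ∀ p a → p - (p - a) ≡ a
    p-[p-a]≡a = solve-∀
    p∣a : + p ∣ a
    p∣a with prime-∣-* p-prime a (+ p - a) (∣-trans (∣ᵤ⇒∣ (m∣m*n q)) pq∣a[p-a])
    ... | inj₁ p∣a   = p∣a
    ... | inj₂ p∣p-a = subst (_ ∣_) (p-[p-a]≡a (+ p) a) (∣m∣n⇒∣m-n ∣-refl p∣p-a)
    p∣p-a : + p ∣ + p - a
    p∣p-a = ∣m∣n⇒∣m-n ∣-refl p∣a

  monomial-from-interior : ∀ {a₁ aₘ} mid → IsSolution (p ℕ.* q) (a₁ ∷ mid ++ aₘ ∷ []) →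
    All (_≈ + p) mid →
    IsSolution (p ℕ.* q) (replicate (length mid) (+ p)) ⊎
    IsSolution (p ℕ.* q) (replicate (suc (suc (length mid))) (+ p))
  monomial-from-interior {a₁} {aₘ} mid sol mid≈p =
    Sum.map unborder unborder-p (a[p-a]≈0⇒a≈0⊎a≈p a₁ a₁[p-a₁]≈0)
    where
    j = length mid
    sol′ : IsSolution (p ℕ.* q) (a₁ ∷ replicate j (+ p) ++ aₘ ∷ [])
    sol′ = IsSolution-cong {a₁ ∷ mid ++ aₘ ∷ []} {a₁ ∷ replicate j (+ p) ++ aₘ ∷ []}
             (≈-refl ∷ Pointwise.++⁺ (All⇒Pointwise-replicate mid≈p) (≈-refl ∷ [])) sol
    a₁≈aₘ : a₁ ≈ aₘ
    a₁≈aₘ = proj₁ (replicate-bordered-congruences {a₁} {aₘ} {+ p} j sol′)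
    a₁[p-a₁]≈0 : a₁ * (+ p - a₁) ≈ + 0
    a₁[p-a₁]≈0 = proj₂ (replicate-bordered-congruences {a₁} {aₘ} {+ p} j sol′)
    unborder : a₁ ≈ + 0 → IsSolution (p ℕ.* q) (replicate j (+ p))
    unborder a₁≈0 = unborder-zeros (replicate j (+ p))
      (bordered-replicate-cong {a₁} {+ 0} {aₘ} {+ 0} j a₁≈0 (≈-trans (≈-sym a₁≈aₘ) a₁≈0) sol′)
    unborder-p : a₁ ≈ + p → IsSolution (p ℕ.* q) (replicate (suc (suc j)) (+ p))
    unborder-p a₁≈p = subst (IsSolution (p ℕ.* q)) (cong (+ p ∷_) (replicate-++-∷ j (+ p)))
      (bordered-replicate-cong {a₁} {+ p} {aₘ} {+ p} j a₁≈p (≈-trans (≈-sym a₁≈aₘ) a₁≈p) sol′)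

  minimal-monomial-irreducible : ∀ {n} → IsMinimalMonomial (p ℕ.* q) (+ p) n →
    Irreducible (p ℕ.* q) (replicate n (+ p))
  minimal-monomial-irreducible (_ , _ , minimal) (a , b , a-sol , _ , 3≤∣a∣ , 3≤∣b∣ , pⁿ∼a⊕b)
    with a⊕b≈p , n≡∣a⊕b∣ ← Equiv-replicate pⁿ∼a⊕b
    with a₁ , mid , aₘ , refl , mid≈p , 1≤j , 2+j<∣a⊕b∣ ← ⊕-interior a b 3≤∣a∣ 3≤∣b∣ a⊕b≈p
    = [ minimal j 1≤j (m+n≤o⇒n≤o 2 2+j<n) , minimal (suc (suc j)) (s≤s z≤n) 2+j<n ]′
        (monomial-from-interior {a₁} {aₘ} mid a-sol mid≈p)
    where
    j = length mid
    2+j<n = subst (suc (suc j) <_) (sym n≡∣a⊕b∣) 2+j<∣a⊕b∣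

-- Only opened here: the modules above open multiplication on ℤ.
open import Data.Nat using (_*_)

proposition3p18 : (p q : ℕ) → Prime p → Prime q → p ≢ q →
    (k : ℤ) → (k ≡ + p ⊎ k ≡ + q) →
    (n : ℕ) → IsMinimalMonomial (p * q) k n →
    Irreducible (p * q) (replicate n k)
proposition3p18 p q p-prime q-prime p≢q k (inj₁ refl) n =
  minimal-monomial-irreducible p-prime q-prime p≢q
proposition3p18 p q p-prime q-prime p≢q k (inj₂ refl) n =
  subst (λ N → IsMinimalMonomial N (+ q) n → Irreducible N (replicate n (+ q)))
        (*-comm q p) (minimal-monomial-irreducible q-prime p-prime (p≢q ∘ sym))
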